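{- Let $q$ be a $\mathrm{BCCSP}_{\|}$ term that does not have $\mathbf{0}$ summands or factors, and let $N\geq 1$. Then $q\sim_{\mathtt{PF}} p_N$ if and only if $q=\sum_{j\in J}q_j$ for some terms $q_j$, none of which has $+$ as head operator, such that: for each $i\in\{1,\dots,N\}$ there is some $j\in J$ with $b^ia\sim_{\mathtt{PF}}q_j$; and for each $j\in J$ there is some $i\in\{1,\dots,N\}$ with $q_j\sim_{\mathtt{PF}}b^ia$.
   Context: Let $\mathcal{A}$ be a finite set of actions containing two distinct actions $a\neq b$, and $\mathcal{V}$ a countably infinite set of variables. $\mathrm{BCCSP}_{\|}$ terms: $t ::= \mathbf{0} \mid x \mid c.t \mid t+t \mid t \,\|\, t$ ($c\in\mathcal{A}$, $x\in\mathcal{V}$). Closed terms are processes. Transitions: $c.p \xrightarrow{c} p$; if $p \xrightarrow{c} p'$ then $p+q \xrightarrow{c} p'$, $q+p \xrightarrow{c} p'$, $p\|q \xrightarrow{c} p'\|q$, $q \| p \xrightarrow{c} q \| p'$. For $\alpha\in\mathcal{A}^*$, $p\xrightarrow{\alpha}p'$ denotes a path labelled $\alpha$; $\mathtt{T}(p)$ is the set of such $\alpha$. A possible future of $p$ is $(\alpha,\mathtt{T}(p'))$ with $p\xrightarrow{\alpha}p'$; processes $p\sim_{\mathtt{PF}}q$ iff they have the same possible futures; for terms, $t\sim_{\mathtt{PF}}u$ iff $\sigma(t)\sim_{\mathtt{PF}}\sigma(u)$ for all closed substitutions $\sigma$. $b^0a$ denotes $a.\mathbf{0}$ and $b^{i+1}a=b.(b^ia)$;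 $p_N=\sum_{i=1}^N b^ia$. A term has a $\mathbf{0}$ summand if it contains a subterm $t_1+t_2$ with $t_1\sim_{\mathtt{PF}}\mathbf{0}$ or $t_2\sim_{\mathtt{PF}}\mathbf{0}$, and a $\mathbf{0}$ factor if it contains a subterm $t_1\|t_2$ with $t_1\sim_{\mathtt{PF}}\mathbf{0}$ or $t_2\sim_{\mathtt{PF}}\mathbf{0}$. -}

module Defs where

open import Data.Nat using (ℕ; zero; suc)
open import Data.Empty using (⊥)
open import Data.List using (List; []; _∷_; [_]; _++_)
open import Data.Product using (Σ; ∃; _×_; _,_)
open import Data.Sum using (_⊎_)
open import Function.Bundles using (_⇔_)

infixr 20 _·_
infixl 10 _⊕_
infixl 15 _∥_

data Term (A : Set) (V : Set) : Set where
  nil : Term A V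
  var : V → Term A V
  _·_ : A → Term A V → Term A V
  _⊕_ : Term A V → Term A V → Term A V
  _∥_ : Term A V → Term A V → Term A V

-- open terms use ℕ as the (countably infinite) set of variables
OTerm : Set → Set
OTerm A = Term A ℕ

Proc : Set → Set
Proc A = Term A ⊥

subst : ∀ {A V W : Set} → (V → Term A W) → Term A V → Term A W
subst σ nil = nil
subst σ (var x) = σ x
subst σ (c · t) = c · subst σ t
subst σ (t ⊕ u) = subst σ t ⊕ subst σ u
subst σ (t ∥ u) = subst σ t ∥ subst σ u

data Step {A : Set} : Proc A → A → Proc A → Set where
  pre  : ∀ {c p} → Step (c · p) c p
  sumˡ : ∀ {p q c p'} → Step p c p' → Step (p ⊕ q) c p'
  sumʳ : ∀ {p q c p'} → Step p c p' → Step (q ⊕ p) c p'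
  parˡ : ∀ {p q c p'} → Step p c p' → Step (p ∥ q) c (p' ∥ q)
  parʳ : ∀ {p q c p'} → Step p c p' → Step (q ∥ p) c (q ∥ p')

data Path {A : Set} : Proc A → List A → Proc A → Set where
  done : ∀ {p} → Path p [] p
  step : ∀ {p c p' α p''} → Step p c p' → Path p' α p'' → Path p (c ∷ α) p''

Trace : ∀ {A : Set} → Proc A → List A → Set
Trace p α = ∃ λ p' → Path p α p'

SameTraces : ∀ {A : Set} → Proc A → Proc A → Set
SameTraces p q = ∀ α → Trace p α ⇔ Trace q α

-- every possible future (α, T(p')) of p is a possible future of q
PFIncl : ∀ {A : Set} → Proc A → Proc A → Set
PFIncl p q = ∀ α p' → Path p α p' → ∃ λ q' → Path q α q' × SameTraces p' q'

_≈PF_ : ∀ {A : Set} → Proc A → Proc A → Set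
p ≈PF q = PFIncl p q × PFIncl q p

_∼PF_ : ∀ {A : Set} → OTerm A → OTerm A → Set
t ∼PF u = ∀ (σ : ℕ → Proc _) → subst σ t ≈PF subst σ u

bpow : ∀ {A V : Set} → A → A → ℕ → Term A V
bpow a b zero = a · nil
bpow a b (suc i) = b · bpow a b i

-- p_N = Σ_{i=1}^N b^i a  (p_0 = nil, unused)
pN : ∀ {A V : Set} → A → A → ℕ → Term A V
pN a b zero = nil
pN a b (suc zero) = bpow a b 1
pN a b (suc (suc k)) = pN a b (suc k) ⊕ bpow a b (suc (suc k))

data HasZeroSummand {A : Set} : OTerm A → Set where
  here  : ∀ {t u} → (t ∼PF nil ⊎ u ∼PF nil) → HasZeroSummand (t ⊕ u)
  pre   : ∀ {c t} → HasZeroSummand t → HasZeroSummand (c · t)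
  sumˡ  : ∀ {t u} → HasZeroSummand t → HasZeroSummand (t ⊕ u)
  sumʳ  : ∀ {t u} → HasZeroSummand u → HasZeroSummand (t ⊕ u)
  parˡ  : ∀ {t u} → HasZeroSummand t → HasZeroSummand (t ∥ u)
  parʳ  : ∀ {t u} → HasZeroSummand u → HasZeroSummand (t ∥ u)

data HasZeroFactor {A : Set} : OTerm A → Set where
  here  : ∀ {t u} → (t ∼PF nil ⊎ u ∼PF nil) → HasZeroFactor (t ∥ u)
  pre   : ∀ {c t} → HasZeroFactor t → HasZeroFactor (c · t)
  sumˡ  : ∀ {t u} → HasZeroFactor t → HasZeroFactor (t ⊕ u)
  sumʳ  : ∀ {t u} → HasZeroFactor u → HasZeroFactor (t ⊕ u)
  parˡ  : ∀ {t u} → HasZeroFactor t → HasZeroFactor (t ∥ u)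
  parʳ  : ∀ {t u} → HasZeroFactor u → HasZeroFactor (t ∥ u)

data PlusHead {A V : Set} : Term A V → Set where
  plus : ∀ {t u} → PlusHead (t ⊕ u)

summands : ∀ {A V : Set} → Term A V → List (Term A V)
summands (t ⊕ u) = summands t ++ summands u
summands t = [ t ]

-- (⇐) Sums whose summands can be matched up to ≈PF, in both directions, are ≈PF.
-- (⇒) Substituting b^(N+1)a for the variables of q would give it a trace longer than any
-- trace of p_N, so q is closed. No summand of q is nil (q has no 0 summands), and none is
-- a parallel composition t ∥ u of two non-stuck processes: running t to completion and
-- then u, or the other way round, gives maximal traces v w and w v with v, w nonempty,
-- whereas every nonempty maximal trace of p_N is a word b^k a, which would force both v
-- and w to consist of b's. So every summand is a prefix c.T all of whose futures are
-- futures of p_N. Its first step gives c = b and T(T) = T(b^j a) for some j; since b^j a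
-- is deterministic and a derivative of some b^k a along a word is determined by that word
-- and its traces, every derivative of T has the traces of the derivative of b^j a along
-- the same word, whence T ≈PF b^j a. Each b^i a is matched by the summand of q that
-- performs its maximal trace b^i a.
module Submission where

open import Defs
open import Data.Nat using (ℕ; zero; suc; _+_; _∸_; _≤_; _≥_; z≤n; s≤s)
open import Data.Nat.Properties
  using (≤-refl; ≤-trans; n≤1+n; ≤-pred; m≤n+m; 1+n≰n; m≤n⇒m<n∨m≡n; module ≤-Reasoning)
open import Data.Fin using (Fin)
open import Data.Empty using (⊥; ⊥-elim)
open import Data.List using (List; []; _∷_; [_]; _++_; length; replicate)
open import Data.List.Properties using (∷-injectiveˡ; ∷-injectiveʳ; ++-conicalʳ; length-++)
open import Data.List.Membership.Propositional using (_∈_)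
open import Data.List.Membership.Propositional.Properties using (∈-++⁺ˡ; ∈-++⁺ʳ; ∈-++⁻)
open import Data.List.Relation.Unary.All using (All; []; _∷_; lookup; tabulate)
open import Data.List.Relation.Unary.All.Properties using (++⁺)
open import Data.List.Relation.Unary.Any using (here; there)
open import Data.List.Relation.Binary.Permutation.Propositional using (_↭_; ↭-refl; ↭-sym)
open import Data.List.Relation.Binary.Permutation.Propositional.Properties using (∈-resp-↭)
open import Data.Product using (Σ; ∃; ∃₂; _×_; _,_; proj₁; proj₂)
open import Data.Sum using (_⊎_; inj₁; inj₂; [_,_]′)
open import Function.Bundles using (_⇔_; mk⇔; Equivalence)
open import Relation.Binary.PropositionalEquality using (_≡_; _≢_; refl; sym; trans; cong; cong₂; subst₂)
  renaming (subst to ≡-subst)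
open import Relation.Nullary using (¬_)

private variable
  A : Set
  c : A
  v w : List A
  p p' q q' s x y : Proc A
  t u : OTerm A

Stuck : Proc A → Set
Stuck p = ∀ {c s} → ¬ Step p c s

⊕-stuck : Stuck p → Stuck q → Stuck (p ⊕ q)
⊕-stuck stk stk' (sumˡ st) = stk st
⊕-stuck stk stk' (sumʳ st) = stk' st

∥-stuck : Stuck p → Stuck q → Stuck (p ∥ q)
∥-stuck stk stk' (parˡ st) = stk st
∥-stuck stk stk' (parʳ st) = stk' st

_▷_ : Path p v p' → Path p' w q → Path p (v ++ w) q
done ▷ ρ = ρ
step st π ▷ ρ = step st (π ▷ ρ)

split : ∀ v → Path p (v ++ w) q → ∃ λ p' → Path p v p' × Path p' w q
split [] π = _ , done , π
split (_ ∷ v) (step st π) with split v π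
... | p' , π₁ , π₂ = p' , step st π₁ , π₂

∥-pathˡ : ∀ q → Path p w p' → Path (p ∥ q) w (p' ∥ q)
∥-pathˡ q done = done
∥-pathˡ q (step st π) = step (parˡ st) (∥-pathˡ q π)

∥-pathʳ : ∀ p → Path q w q' → Path (p ∥ q) w (p ∥ q')
∥-pathʳ p done = done
∥-pathʳ p (step st π) = step (parʳ st) (∥-pathʳ p π)

_⊆T_ : Proc A → Proc A → Set
p ⊆T q = ∀ {w} → Trace p w → Trace q w

SameTraces-refl : SameTraces p p
SameTraces-refl w = mk⇔ (λ tr → tr) (λ tr → tr)

SameTraces-sym : SameTraces p q → SameTraces q p
SameTraces-sym e w = mk⇔ (Equivalence.from (e w)) (Equivalence.to (e w))

⊕-traceˡ : Trace p w → Trace (p ⊕ q) w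
⊕-traceˡ (_ , done) = _ , done
⊕-traceˡ (s , step st π) = s , step (sumˡ st) π

⊕-traceʳ : Trace q w → Trace (p ⊕ q) w
⊕-traceʳ (_ , done) = _ , done
⊕-traceʳ (s , step st π) = s , step (sumʳ st) π

·-⊆T : p ⊆T q → (c · p) ⊆T (c · q)
·-⊆T p⊆q (_ , done) = _ , done
·-⊆T p⊆q (_ , step pre π) with p⊆q (_ , π)
... | q' , ρ = q' , step pre ρ

SameTraces-· : SameTraces p q → SameTraces (c · p) (c · q)
SameTraces-· e w = mk⇔ (·-⊆T (Equivalence.to (e _))) (·-⊆T (Equivalence.from (e _)))

SameTraces-stuck : SameTraces p q → Stuck p → Stuck q
SameTraces-stuck e stk st with Equivalence.from (e [ _ ]) (_ , step st done)
... | _ , step st' _ = stk st'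

stuck-SameTraces : Stuck p → Stuck q → SameTraces p q
stuck-SameTraces stk stk' w = mk⇔ (only-empty stk) (only-empty stk')
  where
  only-empty : ∀ {p q : Proc A} {w} → Stuck p → Trace p w → Trace q w
  only-empty stk (_ , done) = _ , done
  only-empty stk (_ , step st _) = ⊥-elim (stk st)

≈PF-refl : p ≈PF p
≈PF-refl = (λ _ p' π → p' , π , SameTraces-refl) , (λ _ p' π → p' , π , SameTraces-refl)

≈PF-sym : p ≈PF q → q ≈PF p
≈PF-sym (f , g) = g , f

∼PF-sym : t ∼PF u → u ∼PF t
∼PF-sym e σ = ≈PF-sym (e σ)

PFIncl-⊆T : PFIncl p q → p ⊆T q
PFIncl-⊆T f (p' , π) with f _ p' π
... | q' , ρ , _ = q' , ρ

PFIncl⇒SameTraces : PFIncl p q → SameTraces p q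
PFIncl⇒SameTraces f with f [] _ done
... | _ , done , e = e

PFIncl-· : PFIncl p q → PFIncl (c · p) (c · q)
PFIncl-· f [] _ done = _ , done , SameTraces-· (PFIncl⇒SameTraces f)
PFIncl-· f _ _ (step pre π) with f _ _ π
... | q' , ρ , e = q' , step pre ρ , e

≈PF-· : p ≈PF q → (c · p) ≈PF (c · q)
≈PF-· (f , g) = PFIncl-· f , PFIncl-· g

aligned-derivatives⇒≈PF : (∀ {w p' q'} → Path p w p' → Path q w q' → SameTraces p' q') → p ≈PF q
aligned-derivatives⇒≈PF h = incl h , incl (λ π ρ → SameTraces-sym (h ρ π))
  where
  incl : ∀ {p q : Proc A} → (∀ {w p' q'} → Path p w p' → Path q w q' → SameTraces p' q') → PFIncl p q
  incl h w p' π with Equivalence.to (h done done w) (p' , π)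
  ... | q' , ρ = q' , ρ , h π ρ

stuck-≈PF : Stuck p → Stuck q → p ≈PF q
stuck-≈PF {p = p} {q = q} stk stk' = aligned-derivatives⇒≈PF aligned
  where
  aligned : ∀ {w p' q'} → Path p w p' → Path q w q' → SameTraces p' q'
  aligned done done = stuck-SameTraces stk stk'
  aligned (step st _) _ = ⊥-elim (stk st)

-- p ⊑Σ q: every initial step of p is one of some p₀ ≈PF q₀, where q₀ is a "summand" of q
-- in the sense that all its initial steps are initial steps of q.
_⊑Σ_ : Proc A → Proc A → Set
p ⊑Σ q = ∀ {c s} → Step p c s →
  ∃₂ λ p₀ q₀ → Step p₀ c s × p₀ ≈PF q₀ × (∀ {c' s'} → Step q₀ c' s' → Step q c' s')

⊑Σ-path : p ⊑Σ q → Path p (c ∷ w) p' → ∃ λ q' → Path q (c ∷ w) q' × SameTraces p' q'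
⊑Σ-path h (step st π) with h st
... | p₀ , q₀ , st₀ , (f , _) , lift with f _ _ (step st₀ π)
... | q' , step st' ρ , e = q' , step (lift st') ρ , e

⊑Σ-⊆T : p ⊑Σ q → p ⊆T q
⊑Σ-⊆T h (_ , done) = _ , done
⊑Σ-⊆T h (_ , π@(step _ _)) with ⊑Σ-path h π
... | q' , ρ , _ = q' , ρ

⊑Σ-antisym : p ⊑Σ q → q ⊑Σ p → p ≈PF q
⊑Σ-antisym h h' = incl h h' , incl h' h
  where
  incl : ∀ {p q : Proc A} → p ⊑Σ q → q ⊑Σ p → PFIncl p q
  incl h h' [] _ done = _ , done , λ w → mk⇔ (⊑Σ-⊆T h) (⊑Σ-⊆T h')
  incl h h' (_ ∷ _) _ π = ⊑Σ-path h π

MaxTrace : Proc A → List A → Set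
MaxTrace p w = ∃ λ s → Path p w s × Stuck s

maxTrace-∥ : MaxTrace p v → MaxTrace q w → MaxTrace (p ∥ q) (v ++ w) × MaxTrace (p ∥ q) (w ++ v)
maxTrace-∥ {p = p} {q = q} (s , π , stk) (s' , ρ , stk') =
  (s ∥ s' , ∥-pathˡ q π ▷ ∥-pathʳ s ρ , ∥-stuck stk stk') ,
  (s ∥ s' , ∥-pathʳ p ρ ▷ ∥-pathˡ s' π , ∥-stuck stk stk')

maxTrace-exists : (p : Proc A) → ∃ (MaxTrace p)
maxTrace-exists nil = [] , nil , done , λ ()
maxTrace-exists (c · p) with maxTrace-exists p
... | w , s , π , stk = c ∷ w , s , step pre π , stk
maxTrace-exists (p ⊕ q) with maxTrace-exists p | maxTrace-exists q
... | c ∷ w , s , step st π , stk | _ = c ∷ w , s , step (sumˡ st) π , stk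
... | [] , _ , done , _ | c ∷ w , s , step st π , stk = c ∷ w , s , step (sumʳ st) π , stk
... | [] , _ , done , stk | [] , _ , done , stk' = [] , _ , done , ⊕-stuck stk stk'
maxTrace-exists (p ∥ q) with maxTrace-exists p | maxTrace-exists q
... | _ , mp | _ , mq = _ , proj₁ (maxTrace-∥ mp mq)

maxTrace-nonempty : ¬ Stuck p → ∃₂ λ c w → MaxTrace p (c ∷ w)
maxTrace-nonempty {p = p} ¬stk with maxTrace-exists p
... | [] , _ , done , stk = ⊥-elim (¬stk stk)
... | c ∷ w , m = c , w , m

data HasVar {A : Set} : OTerm A → Set where
  var  : ∀ {x} → HasVar (var x)
  pre  : ∀ {c t} → HasVar t → HasVar (c · t)
  sumˡ : ∀ {t u} → HasVar t → HasVar (t ⊕ u)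
  sumʳ : ∀ {t u} → HasVar u → HasVar (t ⊕ u)
  parˡ : ∀ {t u} → HasVar t → HasVar (t ∥ u)
  parʳ : ∀ {t u} → HasVar u → HasVar (t ∥ u)

subst-closed : ∀ (t : OTerm A) (σ σ' : ℕ → Proc A) → ¬ HasVar t → subst σ t ≡ subst σ' t
subst-closed nil σ σ' _ = refl
subst-closed (var _) σ σ' t-closed = ⊥-elim (t-closed var)
subst-closed (c · t) σ σ' t-closed = cong (c ·_) (subst-closed t σ σ' (λ h → t-closed (pre h)))
subst-closed (t ⊕ u) σ σ' closed = cong₂ _⊕_
  (subst-closed t σ σ' (λ h → closed (sumˡ h))) (subst-closed u σ σ' (λ h → closed (sumʳ h)))
subst-closed (t ∥ u) σ σ' closed = cong₂ _∥_
  (subst-closed t σ σ' (λ h → closed (parˡ h))) (subst-closed u σ σ' (λ h → closed (parʳ h)))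

closed-∼PF : ¬ HasVar t → ¬ HasVar u → (σ : ℕ → Proc A) → subst σ t ≈PF subst σ u → t ∼PF u
closed-∼PF {t = t} {u = u} t-closed u-closed σ e σ' =
  subst₂ _≈PF_ (subst-closed t σ σ' t-closed) (subst-closed u σ σ' u-closed) e

closed-¬Stuck : ¬ HasVar t → ¬ (t ∼PF nil) → (σ : ℕ → Proc A) → ¬ Stuck (subst σ t)
closed-¬Stuck t-closed t≁nil σ stk = t≁nil (closed-∼PF {u = nil} t-closed (λ ()) σ (stuck-≈PF stk (λ ())))

HasVar-trace : HasVar t → ∃ λ v → ∀ {p w} → Trace p w → Trace (subst (λ _ → p) t) (v ++ w)
HasVar-trace var = [] , λ tr → tr
HasVar-trace (pre {c} h) with HasVar-trace h
... | v , lift = c ∷ v , λ tr → let (s , π) = lift tr in s , step pre π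
HasVar-trace (sumˡ h) with HasVar-trace h
... | v , lift = v , λ tr → ⊕-traceˡ (lift tr)
HasVar-trace (sumʳ h) with HasVar-trace h
... | v , lift = v , λ tr → ⊕-traceʳ (lift tr)
HasVar-trace (parˡ h) with HasVar-trace h
... | v , lift = v , λ tr → let (s , π) = lift tr in _ , ∥-pathˡ _ π
HasVar-trace (parʳ h) with HasVar-trace h
... | v , lift = v , λ tr → let (s , π) = lift tr in _ , ∥-pathʳ _ π

summands-step⁻ : ∀ (t : OTerm A) {σ} → Step (subst σ t) c s →
  ∃ λ u → u ∈ summands t × Step (subst σ u) c s
summands-step⁻ (var x) st = var x , here refl , st
summands-step⁻ (c · t) st = c · t , here refl , st
summands-step⁻ (t ∥ u) st = t ∥ u , here refl , st
summands-step⁻ (t ⊕ u) (sumˡ st) with summands-step⁻ t st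
... | v , m , st' = v , ∈-++⁺ˡ m , st'
summands-step⁻ (t ⊕ u) (sumʳ st) with summands-step⁻ u st
... | v , m , st' = v , ∈-++⁺ʳ (summands t) m , st'

summands-step⁺ : ∀ (t : OTerm A) {σ} → u ∈ summands t → Step (subst σ u) c s → Step (subst σ t) c s
summands-step⁺ nil (here refl) st = st
summands-step⁺ (var _) (here refl) st = st
summands-step⁺ (_ · _) (here refl) st = st
summands-step⁺ (_ ∥ _) (here refl) st = st
summands-step⁺ (t ⊕ u) m st with ∈-++⁻ (summands t) m
... | inj₁ m' = sumˡ (summands-step⁺ t m' st)
... | inj₂ m' = sumʳ (summands-step⁺ u m' st)

summands-path⁺ : ∀ (t : OTerm A) {σ} → u ∈ summands t →
  Path (subst σ u) (c ∷ w) s → Path (subst σ t) (c ∷ w) s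
summands-path⁺ t m (step st π) = step (summands-step⁺ t m st) π

summand-¬PlusHead : ∀ (t : OTerm A) → u ∈ summands t → ¬ PlusHead u
summand-¬PlusHead nil (here refl) ()
summand-¬PlusHead (var _) (here refl) ()
summand-¬PlusHead (_ · _) (here refl) ()
summand-¬PlusHead (_ ∥ _) (here refl) ()
summand-¬PlusHead (t ⊕ u) m with ∈-++⁻ (summands t) m
... | inj₁ m' = summand-¬PlusHead t m'
... | inj₂ m' = summand-¬PlusHead u m'

summands-inherit : (R : OTerm A → Set) → (∀ {t u} → R (t ⊕ u) → R t × R u) →
  ∀ t → R t → u ∈ summands t → R u
summands-inherit R split-R nil r (here refl) = r
summands-inherit R split-R (var _) r (here refl) = r
summands-inherit R split-R (_ · _) r (here refl) = r
summands-inherit R split-R (_ ∥ _) r (here refl) = r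
summands-inherit R split-R (t ⊕ u) r m with ∈-++⁻ (summands t) m
... | inj₁ m' = summands-inherit R split-R t (proj₁ (split-R r)) m'
... | inj₂ m' = summands-inherit R split-R u (proj₂ (split-R r)) m'

summand-∼nil : ∀ (t : OTerm A) → ¬ HasZeroSummand t → u ∈ summands t → u ∼PF nil → t ≡ u
summand-∼nil nil _ (here refl) _ = refl
summand-∼nil (var _) _ (here refl) _ = refl
summand-∼nil (_ · _) _ (here refl) _ = refl
summand-∼nil (_ ∥ _) _ (here refl) _ = refl
summand-∼nil {u = v} (t ⊕ u) no-zero m v∼nil with ∈-++⁻ (summands t) m
... | inj₁ m' = ⊥-elim (no-zero (here (inj₁
      (≡-subst (_∼PF nil) (sym (summand-∼nil t (λ h → no-zero (sumˡ h)) m' v∼nil)) v∼nil))))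
... | inj₂ m' = ⊥-elim (no-zero (here (inj₂
      (≡-subst (_∼PF nil) (sym (summand-∼nil u (λ h → no-zero (sumʳ h)) m' v∼nil)) v∼nil))))

module Chain {A : Set} (a b : A) where

  B : ℕ → Proc A
  B = bpow a b

  P : ℕ → Proc A
  P = pN a b

  bᵏa : ℕ → List A
  bᵏa zero = [ a ]
  bᵏa (suc k) = b ∷ bᵏa k

  length-bᵏa : ∀ k → length (bᵏa k) ≡ suc k
  length-bᵏa zero = refl
  length-bᵏa (suc k) = cong suc (length-bᵏa k)

  a∈bᵏa : ∀ k → a ∈ bᵏa k
  a∈bᵏa zero = here refl
  a∈bᵏa (suc k) = there (a∈bᵏa k)

  bᵏa-prefix-b : ∀ k v → w ≢ [] → v ++ w ≡ bᵏa k → All (_≡ b) v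
  bᵏa-prefix-b k [] _ _ = []
  bᵏa-prefix-b zero (_ ∷ v) w≢[] e = ⊥-elim (w≢[] (++-conicalʳ v _ (∷-injectiveʳ e)))
  bᵏa-prefix-b (suc k) (_ ∷ v) w≢[] e = ∷-injectiveˡ e ∷ bᵏa-prefix-b k v w≢[] (∷-injectiveʳ e)

  subst-bpow : ∀ {V W : Set} (σ : V → Term A W) k → subst σ (bpow a b k) ≡ bpow a b k
  subst-bpow σ zero = refl
  subst-bpow σ (suc k) = cong (b ·_) (subst-bpow σ k)

  subst-pN : ∀ {V W : Set} (σ : V → Term A W) N → subst σ (pN a b N) ≡ pN a b N
  subst-pN σ zero = refl
  subst-pN σ (suc zero) = subst-bpow σ 1
  subst-pN σ (suc (suc N)) = cong₂ _⊕_ (subst-pN σ (suc N)) (subst-bpow σ (suc (suc N)))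

  bpow-closed : ∀ k → ¬ HasVar (bpow a b k)
  bpow-closed zero (pre ())
  bpow-closed (suc k) (pre h) = bpow-closed k h

  B-path-bᵏa : ∀ k → Path (B k) (bᵏa k) nil
  B-path-bᵏa zero = step pre done
  B-path-bᵏa (suc k) = step pre (B-path-bᵏa k)

  B-¬Stuck : ∀ k → ¬ Stuck (B k)
  B-¬Stuck zero stk = stk pre
  B-¬Stuck (suc k) stk = stk pre

  B-derivative : ∀ {k} → Path (B k) w x →
    (∃ λ m → w ≡ replicate m b × x ≡ B (k ∸ m)) ⊎ (w ≡ bᵏa k × x ≡ nil)
  B-derivative done = inj₁ (0 , refl , refl)
  B-derivative {k = zero} (step pre done) = inj₂ (refl , refl)
  B-derivative {k = zero} (step pre (step () _))
  B-derivative {k = suc k} (step pre π) with B-derivative π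
  ... | inj₁ (m , refl , x≡) = inj₁ (suc m , refl , x≡)
  ... | inj₂ (refl , x≡) = inj₂ (refl , x≡)

  B-deterministic : ∀ {k} → Path (B k) w x → Path (B k) w y → x ≡ y
  B-deterministic done done = refl
  B-deterministic {k = zero} (step pre done) (step pre done) = refl
  B-deterministic {k = zero} (step pre (step () _)) _
  B-deterministic {k = suc k} (step pre π) (step pre ρ) = B-deterministic π ρ

  B-path-length : ∀ {k} → Path (B k) w x → length w ≤ suc k
  B-path-length {k = zero} done = z≤n
  B-path-length {k = zero} (step pre done) = s≤s z≤n
  B-path-length {k = zero} (step pre (step () _))
  B-path-length {k = suc k} done = z≤n
  B-path-length {k = suc k} (step pre π) = s≤s (B-path-length π)

  P-step⁻ : ∀ N → Step (P N) c s → ∃ λ k → 1 ≤ k × k ≤ N × Step (B k) c s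
  P-step⁻ (suc zero) st = 1 , s≤s z≤n , s≤s z≤n , st
  P-step⁻ (suc (suc N)) (sumˡ st) with P-step⁻ (suc N) st
  ... | k , 1≤k , k≤N , st' = k , 1≤k , ≤-trans k≤N (n≤1+n _) , st'
  P-step⁻ (suc (suc N)) (sumʳ st) = suc (suc N) , s≤s z≤n , ≤-refl , st

  P-step⁺ : ∀ N {k} → 1 ≤ k → k ≤ N → Step (B k) c s → Step (P N) c s
  P-step⁺ zero (s≤s _) ()
  P-step⁺ (suc zero) (s≤s z≤n) (s≤s z≤n) st = st
  P-step⁺ (suc (suc N)) 1≤k k≤N st = [ (λ k<N → sumˡ (P-step⁺ (suc N) 1≤k (≤-pred k<N) st))
                                      , (λ { refl → sumʳ st }) ]′ (m≤n⇒m<n∨m≡n k≤N)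

  P-path⁻ : ∀ N → Path (P N) (c ∷ w) s → ∃ λ k → 1 ≤ k × k ≤ N × Path (B k) (c ∷ w) s
  P-path⁻ N (step st π) with P-step⁻ N st
  ... | k , 1≤k , k≤N , st' = k , 1≤k , k≤N , step st' π

  P-trace-bᵏa : ∀ N {k} → 1 ≤ k → k ≤ N → Trace (P N) (bᵏa k)
  P-trace-bᵏa N {suc k} 1≤k k≤N = nil , step (P-step⁺ N 1≤k k≤N pre) (B-path-bᵏa k)

  P-¬Stuck : ∀ {N} → N ≥ 1 → ¬ Stuck (P N)
  P-¬Stuck {N} N≥1 stk = stk (P-step⁺ N (s≤s z≤n) N≥1 pre)

  P-trace-length : ∀ N → Trace (P N) w → length w ≤ suc N
  P-trace-length N (_ , done) = z≤n
  P-trace-length N (_ , π@(step _ _)) with P-path⁻ N π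
  ... | k , _ , k≤N , πk = ≤-trans (B-path-length πk) (s≤s k≤N)

  P-maxTrace : ∀ N → MaxTrace (P N) (c ∷ w) → ∃ λ k → c ∷ w ≡ bᵏa k
  P-maxTrace N (s , π , stk) with P-path⁻ N π
  ... | k , _ , _ , πk with B-derivative πk
  ... | inj₁ (m , _ , refl) = ⊥-elim (B-¬Stuck (k ∸ m) stk)
  ... | inj₂ (e , _) = k , e

  summandwise⇒∼PF-pN : ∀ N (q : OTerm A) →
    (∀ i → 1 ≤ i → i ≤ N → ∃ λ u → u ∈ summands q × bpow a b i ∼PF u) →
    (∀ {u} → u ∈ summands q → ∃ λ i → 1 ≤ i × i ≤ N × u ∼PF bpow a b i) →
    q ∼PF pN a b N
  summandwise⇒∼PF-pN N q covered each σ =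
    ≡-subst (subst σ q ≈PF_) (sym (subst-pN σ N)) (⊑Σ-antisym q⊑P P⊑q)
    where
    q⊑P : subst σ q ⊑Σ P N
    q⊑P st with summands-step⁻ q st
    ... | u , m , st' with each m
    ... | i , 1≤i , i≤N , u∼B =
      _ , B i , st' , ≡-subst (_ ≈PF_) (subst-bpow σ i) (u∼B σ) , P-step⁺ N 1≤i i≤N
    P⊑q : P N ⊑Σ subst σ q
    P⊑q st with P-step⁻ N st
    ... | i , 1≤i , i≤N , st' with covered i 1≤i i≤N
    ... | u , m , B∼u =
      B i , _ , st' , ≡-subst (_≈PF _) (subst-bpow σ i) (B∼u σ) , summands-step⁺ q m

  module _ (a≢b : a ≢ b) where

    bᵏa-injective : ∀ {k k'} → bᵏa k ≡ bᵏa k' → k ≡ k'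
    bᵏa-injective {zero} {zero} _ = refl
    bᵏa-injective {zero} {suc _} e = ⊥-elim (a≢b (∷-injectiveˡ e))
    bᵏa-injective {suc _} {zero} e = ⊥-elim (a≢b (sym (∷-injectiveˡ e)))
    bᵏa-injective {suc _} {suc _} e = cong suc (bᵏa-injective (∷-injectiveʳ e))

    bᵏa≢replicate : ∀ k m → bᵏa k ≢ replicate m b
    bᵏa≢replicate zero (suc m) e = a≢b (∷-injectiveˡ e)
    bᵏa≢replicate (suc k) (suc m) e = bᵏa≢replicate k m (∷-injectiveʳ e)

    bᵏa-not-rotation : ∀ {k k'} → v ≢ [] → w ≢ [] → v ++ w ≡ bᵏa k → w ++ v ≡ bᵏa k' → ⊥
    bᵏa-not-rotation {v = v} {w = w} {k} {k'} v≢[] w≢[] e e' = a≢b (lookup all-b (a∈bᵏa k'))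
      where
      all-b : All (_≡ b) (bᵏa k')
      all-b = ≡-subst (All (_≡ b)) e' (++⁺ (bᵏa-prefix-b k' w v≢[] e') (bᵏa-prefix-b k v w≢[] e))

    B-trace-bᵏa : ∀ {k r} → Trace (B k) (bᵏa r) → r ≡ k
    B-trace-bᵏa (_ , π) with B-derivative π
    ... | inj₁ (m , e , _) = ⊥-elim (bᵏa≢replicate _ m e)
    ... | inj₂ (e , _) = bᵏa-injective e

    B-derivatives-by-traces : ∀ {k k'} → Path (B k) w x → Path (B k') w y → x ⊆T y → x ≡ y
    B-derivatives-by-traces πx πy x⊆y with B-derivative πx | B-derivative πy
    ... | inj₁ (_ , _ , refl) | inj₁ (_ , _ , refl) = cong B (B-trace-bᵏa (x⊆y (_ , B-path-bᵏa _)))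
    ... | inj₁ (m , w≡bᵐ , _) | inj₂ (w≡bᵏa , _) = ⊥-elim (bᵏa≢replicate _ m (trans (sym w≡bᵏa) w≡bᵐ))
    ... | inj₂ (w≡bᵏa , _) | inj₁ (m , w≡bᵐ , _) = ⊥-elim (bᵏa≢replicate _ m (trans (sym w≡bᵏa) w≡bᵐ))
    ... | inj₂ (_ , refl) | inj₂ (_ , refl) = refl

    ∥-maxTrace-not-bᵏa : ¬ Stuck p → ¬ Stuck q →
      ¬ (∀ {c w} → MaxTrace (p ∥ q) (c ∷ w) → ∃ λ k → c ∷ w ≡ bᵏa k)
    ∥-maxTrace-not-bᵏa ¬stk ¬stk' all-bᵏa with maxTrace-nonempty ¬stk | maxTrace-nonempty ¬stk'
    ... | c , v , mp | c' , w , mq with maxTrace-∥ mp mq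
    ... | m₁ , m₂ with all-bᵏa m₁ | all-bᵏa m₂
    ... | _ , e | _ , e' = bᵏa-not-rotation {v = c ∷ v} {w = c' ∷ w} (λ ()) (λ ()) e e'

    prefix-≈PF-bpow : ∀ N c T →
      (∀ {w T'} → Path T w T' → ∃ λ r → Path (P N) (c ∷ w) r × SameTraces T' r) →
      ∃ λ k → 1 ≤ k × k ≤ N × (c · T) ≈PF B k
    prefix-≈PF-bpow N c T futures with futures done
    ... | _ , step st done , T≡Bj with P-step⁻ N st
    ... | zero , () , _
    ... | suc j , 1≤k , k≤N , pre = suc j , 1≤k , k≤N , ≈PF-· (aligned-derivatives⇒≈PF aligned)
      where
      aligned : ∀ {w T' B'} → Path T w T' → Path (B j) w B' → SameTraces T' B'
      aligned {w} {T'} {B'} πT πB with futures πT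
      ... | r , πr , T'≡r with P-path⁻ N πr
      ... | _ , _ , _ , πk =
        ≡-subst (SameTraces T') (B-derivatives-by-traces {k' = suc j} πk (step pre πB) r⊆B') T'≡r
        where
        r⊆B' : r ⊆T B'
        r⊆B' tr with Equivalence.to (T≡Bj _) (_ , πT ▷ proj₂ (Equivalence.from (T'≡r _) tr))
        ... | _ , π with split w π
        ... | _ , π₁ , π₂ = _ , ≡-subst (λ z → Path z _ _) (B-deterministic π₁ πB) π₂

    module Forward (N : ℕ) (N≥1 : N ≥ 1) (q : OTerm A)
                   (no-zero-summand : ¬ HasZeroSummand q) (no-zero-factor : ¬ HasZeroFactor q)
                   (q∼P : q ∼PF pN a b N) where

      subst-q≈P : ∀ σ → subst σ q ≈PF P N
      subst-q≈P σ = ≡-subst (subst σ q ≈PF_) (subst-pN σ N) (q∼P σ)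

      q-closed : ¬ HasVar q
      q-closed hv with HasVar-trace hv
      ... | v , lift = 1+n≰n (begin
          suc (suc N)                ≤⟨ m≤n+m _ (length v) ⟩
          length v + suc (suc N)     ≡⟨ sym (trans (length-++ v) (cong (length v +_) (length-bᵏa (suc N)))) ⟩
          length (v ++ bᵏa (suc N))  ≤⟨ P-trace-length N long-trace ⟩
          suc N                      ∎)
        where
        open ≤-Reasoning
        long-trace : Trace (P N) (v ++ bᵏa (suc N))
        long-trace = PFIncl-⊆T (proj₁ (subst-q≈P _)) (lift (_ , B-path-bᵏa (suc N)))

      σ₀ : ℕ → Proc A
      σ₀ _ = nil

      summand-closed : u ∈ summands q → ¬ HasVar u
      summand-closed = summands-inherit (λ t → ¬ HasVar t)
        (λ n → (λ h → n (sumˡ h)) , (λ h → n (sumʳ h))) q q-closed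

      summand-no-zero-factor : u ∈ summands q → ¬ HasZeroFactor u
      summand-no-zero-factor = summands-inherit (λ t → ¬ HasZeroFactor t)
        (λ n → (λ h → n (sumˡ h)) , (λ h → n (sumʳ h))) q no-zero-factor

      summand-futures : u ∈ summands q → Path (subst σ₀ u) (c ∷ w) s →
        ∃ λ r → Path (P N) (c ∷ w) r × SameTraces s r
      summand-futures m π = proj₁ (subst-q≈P σ₀) _ _ (summands-path⁺ q m π)

      summand-∼PF-bpow : u ∈ summands q → ∃ λ k → 1 ≤ k × k ≤ N × u ∼PF bpow a b k
      summand-∼PF-bpow {nil} m =
        ⊥-elim (P-¬Stuck N≥1 (SameTraces-stuck (PFIncl⇒SameTraces (proj₁ nil≈P)) (λ ())))
        where
        nil≈P : nil ≈PF P N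
        nil≈P = ≡-subst (λ t → subst σ₀ t ≈PF P N)
                        (summand-∼nil q no-zero-summand m (λ _ → ≈PF-refl)) (subst-q≈P σ₀)
      summand-∼PF-bpow {var _} m = ⊥-elim (summand-closed m var)
      summand-∼PF-bpow {_ ⊕ _} m = ⊥-elim (summand-¬PlusHead q m plus)
      summand-∼PF-bpow {t ∥ u} m = ⊥-elim (∥-maxTrace-not-bᵏa t-¬Stuck u-¬Stuck maxTrace-bᵏa)
        where
        t-¬Stuck : ¬ Stuck (subst σ₀ t)
        t-¬Stuck = closed-¬Stuck (λ h → summand-closed m (parˡ h))
                                 (λ t∼nil → summand-no-zero-factor m (here (inj₁ t∼nil))) σ₀
        u-¬Stuck : ¬ Stuck (subst σ₀ u)
        u-¬Stuck = closed-¬Stuck (λ h → summand-closed m (parʳ h))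
                                 (λ u∼nil → summand-no-zero-factor m (here (inj₂ u∼nil))) σ₀
        maxTrace-bᵏa : ∀ {c w} → MaxTrace (subst σ₀ (t ∥ u)) (c ∷ w) → ∃ λ k → c ∷ w ≡ bᵏa k
        maxTrace-bᵏa (_ , π , stk) with summand-futures m π
        ... | r , ρ , e = P-maxTrace N (r , ρ , SameTraces-stuck e stk)
      summand-∼PF-bpow {c · t} m with prefix-≈PF-bpow N c (subst σ₀ t) (λ π → summand-futures m (step pre π))
      ... | k , 1≤k , k≤N , e = k , 1≤k , k≤N ,
        closed-∼PF (summand-closed m) (bpow-closed k) σ₀ (≡-subst (_ ≈PF_) (sym (subst-bpow σ₀ k)) e)

      summands-cover : ∀ i → 1 ≤ i → i ≤ N → ∃ λ u → u ∈ summands q × bpow a b i ∼PF u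
      summands-cover (suc i) 1≤i i≤N with PFIncl-⊆T (proj₂ (subst-q≈P σ₀)) (P-trace-bᵏa N 1≤i i≤N)
      ... | s , step st π with summands-step⁻ q st
      ... | u , m , st' with summand-∼PF-bpow m
      ... | k , _ , _ , u∼B with PFIncl-⊆T (proj₁ (u∼B σ₀)) (s , step st' π)
      ... | tr = u , m , ≡-subst (λ j → bpow a b j ∼PF u) (sym k≡i) (∼PF-sym {t = u} {u = bpow a b k} u∼B)
        where
        k≡i : suc i ≡ k
        k≡i = B-trace-bᵏa (≡-subst (λ z → Trace z _) (subst-bpow σ₀ k) tr)

lemma6p5 : (n : ℕ) (a b : Fin n) → a ≢ b → (q : OTerm (Fin n)) →
    ¬ HasZeroSummand q → ¬ HasZeroFactor q → (N : ℕ) → N ≥ 1 →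
    (q ∼PF pN a b N) ⇔
    (Σ (List (OTerm (Fin n))) λ qs →
      (summands q ↭ qs) × All (λ qj → ¬ PlusHead qj) qs ×
      (∀ i → 1 ≤ i → i ≤ N → Σ (OTerm (Fin n)) λ qj → qj ∈ qs × (bpow a b i ∼PF qj)) ×
      (∀ qj → qj ∈ qs → Σ ℕ λ i → 1 ≤ i × i ≤ N × (qj ∼PF bpow a b i)))
lemma6p5 n a b a≢b q no-zero-summand no-zero-factor N N≥1 = mk⇔
  (λ q∼P → let open Forward a≢b N N≥1 q no-zero-summand no-zero-factor q∼P in
    summands q , ↭-refl , tabulate (summand-¬PlusHead q) , summands-cover , λ _ → summand-∼PF-bpow)
  (λ (_ , perm , _ , covered , each) → summandwise⇒∼PF-pN N q
    (λ i 1≤i i≤N → let (u , m , B∼u) = covered i 1≤i i≤N in u , ∈-resp-↭ (↭-sym perm) m , B∼u)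
    (λ m → each _ (∈-resp-↭ perm m)))
  where open Chain a b
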